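{- There do not exist rational functions $a,b,c\in\mathbb{R}(x)$ such that for every finite simple graph $G$ and every edge $e$ of $G$, \[ D(G,x)=a\,D(G-e,x)+b\,D(G/e,x)+c\,D(G\dagger e,x). \]
   Context: The domination polynomial of a finite simple graph $G=(V,E)$ is $D(G,x)=\sum_{W\subseteq V,\ N_G[W]=V}x^{|W|}$, where $N_G[W]$ is the closed neighborhood of $W$; the graph with no vertices has $D=1$. For an edge $e=\{u,v\}$: - $G-e$ removes the edge $e$. - $G/e$ removes $e$ and identifies its endpoints $u,v$ into a single vertex adjacent to all former neighbors of $u$ and $v$, giving a simple graph. - $G\dagger e$ (edge extraction) is the graph $G-u-v$ obtained by deleting both endpoints and all incident edges. -}

module Defs where

open import Level using (Level; _⊔_)
open import Data.Nat using (ℕ; zero; suc)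
open import Data.Bool using (Bool; true; false; _∧_; _∨_; not; if_then_else_)
open import Data.Fin using (Fin; zero; suc; _≟_)
open import Data.List using (List; []; _∷_; map; length; filter; upTo; allFin; concatMap)
open import Data.Bool.ListAction using (all; any)
open import Data.Product using (Σ; _,_; ∃)
open import Relation.Nullary using (¬_; does)
open import Relation.Binary.PropositionalEquality using (_≡_)
open import Algebra.Bundles using (CommutativeRing)

record Graph (n : ℕ) : Set where
  field
    adj    : Fin n → Fin n → Bool
    sym    : ∀ i j → adj i j ≡ adj j i
    irrefl : ∀ i → adj i i ≡ false
open Graph public

_==_ : ∀ {n} → Fin n → Fin n → Bool
i == j = does (i ≟ j)

VSet : ℕ → Set
VSet n = Fin n → Bool

allSubsets : (n : ℕ) → List (VSet n)
allSubsets zero    = (λ ()) ∷ []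
allSubsets (suc n) = concatMap (λ S → ext false S ∷ ext true S ∷ []) (allSubsets n)
  where
  ext : Bool → VSet n → VSet (suc n)
  ext b S zero    = b
  ext b S (suc i) = S i

card : ∀ {n} → VSet n → ℕ
card {n} S = length (filter (λ i → S i Data.Bool.≟ true) (allFin n))

_⊆ᵇ_ : ∀ {n} → VSet n → VSet n → Bool
_⊆ᵇ_ {n} W S = all (λ i → not (W i) ∨ S i) (allFin n)

-- Domination polynomial of the induced subgraph G[S] (vertex set S,
-- edges of G between vertices of S), as the list of its coefficients
-- (index k = number of dominating sets of size k).

Adj : ℕ → Set
Adj n = Fin n → Fin n → Bool

dominatesᵇ : ∀ {n} → Adj n → VSet n → VSet n → Bool
dominatesᵇ {n} A S W =
  all (λ v → not (S v) ∨ any (λ w → W w ∧ ((w == v) ∨ A w v)) (allFin n)) (allFin n)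

domCoeff : ∀ {n} → Adj n → VSet n → ℕ → ℕ
domCoeff {n} A S k =
  length (filter (λ W → (W ⊆ᵇ S ∧ dominatesᵇ A S W ∧ does (card W Data.Nat.≟ k)) Data.Bool.≟ true)
                 (allSubsets n))

domPolyInduced : ∀ {n} → Adj n → VSet n → List ℕ
domPolyInduced {n} A S = map (domCoeff A S) (upTo (suc n))

fullSet : ∀ {n} → VSet n
fullSet _ = true

domPoly : ∀ {n} → Graph n → List ℕ
domPoly G = domPolyInduced (adj G) fullSet

deleteEdgeAdj : ∀ {n} → Graph n → Fin n → Fin n → Fin n → Fin n → Bool
deleteEdgeAdj G u v i j =
  adj G i j ∧ not (((i == u) ∧ (j == v)) ∨ ((i == v) ∧ (j == u)))

-- G / e, realised on the vertex set V ∖ {v}: the merged vertex is u,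
-- adjacent to every former neighbour of u or of v (other than u, v).
-- 'contractAdj' is a graph on Fin n in which v is isolated; G/e is its
-- induced subgraph on V ∖ {v}.
contractAdj : ∀ {n} → Graph n → Fin n → Fin n → Fin n → Fin n → Bool
contractAdj G u v i j =
  not (i == j) ∧ not (i == v) ∧ not (j == v) ∧
  (adj G i j ∨ ((i == u) ∧ adj G v j) ∨ ((j == u) ∧ adj G v i))

-- Polynomials over a commutative ring, as coefficient lists
-- (lowest degree first); equality is coefficientwise, trailing zeros
-- ignored.

module Poly {c ℓ} (R : CommutativeRing c ℓ) where
  open CommutativeRing R

  Pol : Set c
  Pol = List Carrier

  coeff : Pol → ℕ → Carrier
  coeff []       _       = 0#
  coeff (a ∷ p)  zero    = a
  coeff (a ∷ p)  (suc k) = coeff p k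

  _≈P_ : Pol → Pol → Set ℓ
  p ≈P q = ∀ k → coeff p k ≈ coeff q k

  _+P_ : Pol → Pol → Pol
  []      +P q       = q
  (a ∷ p) +P []      = a ∷ p
  (a ∷ p) +P (b ∷ q) = (a + b) ∷ (p +P q)

  _*P_ : Pol → Pol → Pol
  []      *P q = []
  (a ∷ p) *P q = map (a *_) q +P (0# ∷ (p *P q))

  fromℕ : ℕ → Carrier
  fromℕ zero    = 0#
  fromℕ (suc m) = 1# + fromℕ m

  embed : List ℕ → Pol
  embed = map fromℕ

  record RatFun : Set (c ⊔ ℓ) where
    constructor _/_∶_
    field
      num    : Pol
      den    : Pol
      den≢0  : ¬ (den ≈P [])
  open RatFun public

  _≈F_ : RatFun → RatFun → Set ℓ
  f ≈F g = (num f *P den g) ≈P (num g *P den f)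

  -- a·P₁ + b·P₂ + c·P₃ for fractions a, b, c and polynomials Pᵢ is the
  -- fraction numSum3 / denSum3 (common denominator den a · den b · den c).
  numSum3 : RatFun → Pol → RatFun → Pol → RatFun → Pol → Pol
  numSum3 a p b q f r =
    ((num a *P p) *P (den b *P den f)) +P
    (((num b *P q) *P (den a *P den f)) +P
     ((num f *P r) *P (den a *P den b)))

  denSum3 : RatFun → RatFun → RatFun → Pol
  denSum3 a b f = den a *P (den b *P den f)

  -- the identity  P = a·P₁ + b·P₂ + c·P₃  in R(x), for polynomials
  -- P, P₁, P₂, P₃ (i.e. P/1 equals the fraction  numSum3 / denSum3).
  LinComb3 : Pol → RatFun → Pol → RatFun → Pol → RatFun → Pol → Set ℓ
  LinComb3 P a P₁ b P₂ f P₃ =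
    (P *P denSum3 a b f) ≈P numSum3 a P₁ b P₂ f P₃

record IsCharZeroField {c ℓ} (R : CommutativeRing c ℓ) : Set (c ⊔ ℓ) where
  open CommutativeRing R
  open Poly R using (fromℕ)
  field
    nontrivial : ¬ (1# ≈ 0#)
    inverse    : ∀ x → ¬ (x ≈ 0#) → ∃ λ y → (x * y) ≈ 1#
    charZero   : ∀ m → ¬ (fromℕ (suc m) ≈ 0#)

module _ {c ℓ} (K : CommutativeRing c ℓ) where
  open Poly K

  domPolyDelete : ∀ {n} → Graph n → Fin n → Fin n → List ℕ
  domPolyDelete G u v = domPolyInduced (deleteEdgeAdj G u v) fullSet

  domPolyContract : ∀ {n} → Graph n → Fin n → Fin n → List ℕ
  domPolyContract G u v = domPolyInduced (contractAdj G u v) (λ i → not (i == v))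

  -- D(G † e, x) = D(G - u - v, x): induced subgraph on V ∖ {u , v}
  domPolyExtract : ∀ {n} → Graph n → Fin n → Fin n → List ℕ
  domPolyExtract G u v = domPolyInduced (adj G) (λ i → not (i == u) ∧ not (i == v))

  RecurrenceHolds : RatFun → RatFun → RatFun → Set ℓ
  RecurrenceHolds a b f =
    ∀ (n : ℕ) (G : Graph n) (u v : Fin n) → adj G u v ≡ true →
      LinComb3 (embed (domPoly G))
               a (embed (domPolyDelete G u v))
               b (embed (domPolyContract G u v))
               f (embed (domPolyExtract G u v))

-- Idea: exhibit two graphs with an edge e = {0,1} whose three "operand"
-- polynomials coincide although their domination polynomials differ.
-- The path P₄ = 3-0-1-2 and the paw (triangle 0,1,2 with a pendant
-- vertex 3 at 0) do this:  G - e, G / e and G † e have domination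
-- polynomials x⁴+4x³+4x², x³+3x²+x and x² for both, whereas
-- D(P₄) = x⁴+4x³+4x² and D(paw) = x⁴+4x³+5x²+x.  Clearing denominators,
-- the recurrence for both graphs gives (D(P₄) - D(paw))·d = 0 with d the
-- product of the denominators of a, b, c; over a field K[x] has no zero
-- divisors, and both factors are non-zero, a contradiction.
module Submission where

open import Algebra.Bundles using (CommutativeRing)
open import Data.Bool using (Bool; true; false; _∨_)
open import Data.Bool.Properties using (∨-comm)
open import Data.Fin using (Fin; zero; suc)
open import Data.List using (List; []; _∷_; map)
open import Data.Nat using (ℕ; zero; suc)
open import Level using (_⊔_)
open import Data.Product using (Σ; _,_)
open import Relation.Nullary using (¬_; yes; no)
open import Relation.Nullary.Decidable using (¬¬-excluded-middle)
open import Relation.Binary.PropositionalEquality as ≡ using (_≡_)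
open import Defs using (Graph; IsCharZeroField; module Poly; RecurrenceHolds)

module PolynomialAlgebra {c ℓ} (R : CommutativeRing c ℓ) where
  open CommutativeRing R hiding (zero)
  open Poly R
  open import Algebra.Properties.Ring ring
    using (-0#≈0#; -‿+-comm; [y-z]x≈yx-zx)
  open import Algebra.Properties.CommutativeSemigroup +-commutativeSemigroup
    using (interchange)
  open import Relation.Binary.Reasoning.Setoid setoid

  _-P_ : Pol → Pol → Pol
  p -P q = p +P map -_ q

  coeff-+P : ∀ p q k → coeff (p +P q) k ≈ coeff p k + coeff q k
  coeff-+P []      q       k       = sym (+-identityˡ _)
  coeff-+P (a ∷ p) []      k       = sym (+-identityʳ _)
  coeff-+P (a ∷ p) (b ∷ q) zero    = refl
  coeff-+P (a ∷ p) (b ∷ q) (suc k) = coeff-+P p q k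

  coeff-scale : ∀ a q k → coeff (map (a *_) q) k ≈ a * coeff q k
  coeff-scale a []      k       = sym (zeroʳ a)
  coeff-scale a (b ∷ q) zero    = refl
  coeff-scale a (b ∷ q) (suc k) = coeff-scale a q k

  coeff-neg : ∀ q k → coeff (map -_ q) k ≈ - coeff q k
  coeff-neg []      k       = sym -0#≈0#
  coeff-neg (b ∷ q) zero    = refl
  coeff-neg (b ∷ q) (suc k) = coeff-neg q k

  coeff--P : ∀ p q k → coeff (p -P q) k ≈ coeff p k - coeff q k
  coeff--P p q k = trans (coeff-+P p (map -_ q) k) (+-congˡ (coeff-neg q k))

  -- convolve f d k = Σ_{i ≤ k} f i · d_{k-i}: the k-th coefficient of the
  -- product of the series with coefficients f and the polynomial d.
  convolve : (ℕ → Carrier) → Pol → ℕ → Carrier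
  convolve f d zero    = f 0 * coeff d 0
  convolve f d (suc k) = f 0 * coeff d (suc k) + convolve (λ i → f (suc i)) d k

  coeff-*P : ∀ p d k → coeff (p *P d) k ≈ convolve (coeff p) d k
  coeff-*P []      d zero    = sym (zeroˡ _)
  coeff-*P []      d (suc k) = begin
    0#                                              ≈⟨ coeff-*P [] d k ⟩
    convolve (coeff []) d k                         ≈⟨ +-identityˡ _ ⟨
    0# + convolve (coeff []) d k                    ≈⟨ +-congʳ (zeroˡ _) ⟨
    0# * coeff d (suc k) + convolve (coeff []) d k  ∎
  coeff-*P (a ∷ p) d zero    = begin
    coeff (map (a *_) d +P (0# ∷ (p *P d))) 0 ≈⟨ coeff-+P (map (a *_) d) (0# ∷ (p *P d)) 0 ⟩
    coeff (map (a *_) d) 0 + 0#               ≈⟨ +-identityʳ _ ⟩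
    coeff (map (a *_) d) 0                    ≈⟨ coeff-scale a d 0 ⟩
    a * coeff d 0                             ∎
  coeff-*P (a ∷ p) d (suc k) = begin
    coeff (map (a *_) d +P (0# ∷ (p *P d))) (suc k)     ≈⟨ coeff-+P (map (a *_) d) (0# ∷ (p *P d)) (suc k) ⟩
    coeff (map (a *_) d) (suc k) + coeff (p *P d) k     ≈⟨ +-cong (coeff-scale a d (suc k)) (coeff-*P p d k) ⟩
    a * coeff d (suc k) + convolve (coeff p) d k        ∎

  convolve-cong : ∀ f g d k → (∀ i → f i ≈ g i) → convolve f d k ≈ convolve g d k
  convolve-cong f g d zero    f≈g = *-congʳ (f≈g 0)
  convolve-cong f g d (suc k) f≈g =
    +-cong (*-congʳ (f≈g 0)) (convolve-cong _ _ d k (λ i → f≈g (suc i)))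

  convolve-sub : ∀ f g d k →
    convolve (λ i → f i - g i) d k ≈ convolve f d k - convolve g d k
  convolve-sub f g d zero    = [y-z]x≈yx-zx (coeff d 0) (f 0) (g 0)
  convolve-sub f g d (suc k) = begin
    (f 0 - g 0) * x + convolve (λ i → f (suc i) - g (suc i)) d k
      ≈⟨ +-cong ([y-z]x≈yx-zx x (f 0) (g 0)) (convolve-sub (λ i → f (suc i)) (λ i → g (suc i)) d k) ⟩
    (f 0 * x - g 0 * x) + (F - G)
      ≈⟨ interchange (f 0 * x) (- (g 0 * x)) F (- G) ⟩
    (f 0 * x + F) + (- (g 0 * x) + - G)
      ≈⟨ +-congˡ (-‿+-comm (g 0 * x) G) ⟩
    (f 0 * x + F) - (g 0 * x + G) ∎
    where
    x = coeff d (suc k)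
    F = convolve (λ i → f (suc i)) d k
    G = convolve (λ i → g (suc i)) d k

  *P-distribʳ--P : ∀ p q d k →
    coeff ((p -P q) *P d) k ≈ coeff (p *P d) k - coeff (q *P d) k
  *P-distribʳ--P p q d k = begin
    coeff ((p -P q) *P d) k                       ≈⟨ coeff-*P (p -P q) d k ⟩
    convolve (coeff (p -P q)) d k                 ≈⟨ convolve-cong _ _ d k (coeff--P p q) ⟩
    convolve (λ i → coeff p i - coeff q i) d k    ≈⟨ convolve-sub (coeff p) (coeff q) d k ⟩
    convolve (coeff p) d k - convolve (coeff q) d k
      ≈⟨ +-cong (sym (coeff-*P p d k)) (-‿cong (sym (coeff-*P q d k))) ⟩
    coeff (p *P d) k - coeff (q *P d) k           ∎

  linComb3-difference : ∀ P Q a b f {P₁ P₂ P₃} →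
    LinComb3 P a P₁ b P₂ f P₃ → LinComb3 Q a P₁ b P₂ f P₃ →
    ((P -P Q) *P denSum3 a b f) ≈P []
  linComb3-difference P Q a b f hP hQ k = begin
    coeff ((P -P Q) *P d) k               ≈⟨ *P-distribʳ--P P Q d k ⟩
    coeff (P *P d) k - coeff (Q *P d) k   ≈⟨ +-congʳ (trans (hP k) (sym (hQ k))) ⟩
    coeff (Q *P d) k - coeff (Q *P d) k   ≈⟨ -‿inverseʳ _ ⟩
    0#                                    ∎
    where d = denSum3 a b f

  convolve-shiftˡ : ∀ f d k → f 0 ≈ 0# →
    convolve f d (suc k) ≈ convolve (λ i → f (suc i)) d k
  convolve-shiftˡ f d k f0≈0 =
    trans (+-congʳ (trans (*-congʳ f0≈0) (zeroˡ _))) (+-identityˡ _)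

  convolve-shiftʳ : ∀ f b q k → b ≈ 0# →
    convolve f (b ∷ q) (suc k) ≈ convolve f q k
  convolve-shiftʳ f b q zero    b≈0 =
    trans (+-congˡ (trans (*-congˡ b≈0) (zeroʳ _))) (+-identityʳ _)
  convolve-shiftʳ f b q (suc k) b≈0 =
    +-congˡ (convolve-shiftʳ (λ i → f (suc i)) b q k b≈0)

  ∷-zero : ∀ {a p} → a ≈ 0# → p ≈P [] → (a ∷ p) ≈P []
  ∷-zero a≈0 p≈0 zero    = a≈0
  ∷-zero a≈0 p≈0 (suc k) = p≈0 k

  NoZeroDivisors : Set (c ⊔ ℓ)
  NoZeroDivisors = ∀ a b → ¬ (a ≈ 0#) → ¬ (b ≈ 0#) → ¬ ((a * b) ≈ 0#)

  -- The proof strips zero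
  -- lowest coefficients until both factors start with non-zero ones a, b,
  -- whose product a·b is the lowest coefficient of the product; whether a
  -- coefficient vanishes is decided under a double negation.
  module _ (noZeroDivisors : NoZeroDivisors) where

    *P-nonzero : ∀ p q → ¬ (p ≈P []) → ¬ (q ≈P []) → ¬ ((p *P q) ≈P [])
    *P-nonzero []      q p≢0 q≢0 pq≈0 = p≢0 (λ _ → refl)
    *P-nonzero (a ∷ p) q p≢0 q≢0 pq≈0 = ¬¬-excluded-middle λ
      { (yes a≈0) → *P-nonzero p q (λ p≈0 → p≢0 (∷-zero a≈0 p≈0)) q≢0 λ k → begin
          coeff (p *P q) k                  ≈⟨ coeff-*P p q k ⟩
          convolve (coeff p) q k            ≈⟨ convolve-shiftˡ (coeff (a ∷ p)) q k a≈0 ⟨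
          convolve (coeff (a ∷ p)) q (suc k) ≈⟨ coeff-*P (a ∷ p) q (suc k) ⟨
          coeff ((a ∷ p) *P q) (suc k)      ≈⟨ pq≈0 (suc k) ⟩
          0#                                ∎
      ; (no a≉0) → with-nonzero-head a p a≉0 q q≢0 pq≈0 }
      where
      with-nonzero-head : ∀ a p → ¬ (a ≈ 0#) → ∀ q → ¬ (q ≈P []) →
                          ¬ (((a ∷ p) *P q) ≈P [])
      with-nonzero-head a p a≉0 []      q≢0 _    = q≢0 (λ _ → refl)
      with-nonzero-head a p a≉0 (b ∷ q) q≢0 pq≈0 = ¬¬-excluded-middle λ
        { (yes b≈0) → with-nonzero-head a p a≉0 q (λ q≈0 → q≢0 (∷-zero b≈0 q≈0)) λ k → begin
            coeff ((a ∷ p) *P q) k                 ≈⟨ coeff-*P (a ∷ p) q k ⟩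
            convolve (coeff (a ∷ p)) q k           ≈⟨ convolve-shiftʳ (coeff (a ∷ p)) b q k b≈0 ⟨
            convolve (coeff (a ∷ p)) (b ∷ q) (suc k) ≈⟨ coeff-*P (a ∷ p) (b ∷ q) (suc k) ⟨
            coeff ((a ∷ p) *P (b ∷ q)) (suc k)     ≈⟨ pq≈0 (suc k) ⟩
            0#                                     ∎
        ; (no b≉0) → noZeroDivisors a b a≉0 b≉0 (trans (sym (coeff-*P (a ∷ p) (b ∷ q) 0)) (pq≈0 0)) }

    denSum3-nonzero : ∀ a b f → ¬ (denSum3 a b f ≈P [])
    denSum3-nonzero a b f =
      *P-nonzero (den a) (den b *P den f) (den≢0 a)
        (*P-nonzero (den b) (den f) (den≢0 b) (den≢0 f))

field-noZeroDivisors : ∀ {c ℓ} {K : CommutativeRing c ℓ} → IsCharZeroField K →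
                       PolynomialAlgebra.NoZeroDivisors K
field-noZeroDivisors {K = K} F a b a≉0 b≉0 ab≈0 with IsCharZeroField.inverse F a a≉0
... | a⁻¹ , aa⁻¹≈1 = b≉0 (begin
    b              ≈⟨ *-identityˡ b ⟨
    1# * b         ≈⟨ *-congʳ aa⁻¹≈1 ⟨
    (a * a⁻¹) * b  ≈⟨ *-congʳ (*-comm a a⁻¹) ⟩
    (a⁻¹ * a) * b  ≈⟨ *-assoc a⁻¹ a b ⟩
    a⁻¹ * (a * b)  ≈⟨ *-congˡ ab≈0 ⟩
    a⁻¹ * 0#       ≈⟨ zeroʳ a⁻¹ ⟩
    0#             ∎)
  where
  open CommutativeRing K
  open import Relation.Binary.Reasoning.Setoid setoid

fromEdges : ∀ {n} (E : Fin n → Fin n → Bool) → (∀ i → E i i ≡ false) → Graph n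
fromEdges E loopless = record
  { adj    = λ i j → E i j ∨ E j i
  ; sym    = λ i j → ∨-comm (E i j) (E j i)
  ; irrefl = λ i → ≡.cong (λ b → b ∨ b) (loopless i)
  }

pattern v₀ = zero
pattern v₁ = suc zero
pattern v₂ = suc (suc zero)
pattern v₃ = suc (suc (suc zero))

pathEdge : Fin 4 → Fin 4 → Bool
pathEdge v₃ v₀ = true
pathEdge v₀ v₁ = true
pathEdge v₁ v₂ = true
pathEdge _  _  = false

pathEdge-loopless : ∀ i → pathEdge i i ≡ false
pathEdge-loopless v₀ = ≡.refl
pathEdge-loopless v₁ = ≡.refl
pathEdge-loopless v₂ = ≡.refl
pathEdge-loopless v₃ = ≡.refl

path : Graph 4
path = fromEdges pathEdge pathEdge-loopless

pawEdge : Fin 4 → Fin 4 → Bool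
pawEdge v₀ v₁ = true
pawEdge v₀ v₂ = true
pawEdge v₀ v₃ = true
pawEdge v₁ v₂ = true
pawEdge _  _  = false

pawEdge-loopless : ∀ i → pawEdge i i ≡ false
pawEdge-loopless v₀ = ≡.refl
pawEdge-loopless v₁ = ≡.refl
pawEdge-loopless v₂ = ≡.refl
pawEdge-loopless v₃ = ≡.refl

paw : Graph 4
paw = fromEdges pawEdge pawEdge-loopless

-- Domination polynomials (coefficient lists, lowest degree first) of the
-- two graphs and of the three operands for e = {0,1}, which agree:
-- G - e is 2K₂ for the path and P₄ for the paw, G / e is P₃ for both, and
-- G † e is two isolated vertices for both.
D-path D-paw D-delete D-contract D-extract : List ℕ
D-path     = 0 ∷ 0 ∷ 4 ∷ 4 ∷ 1 ∷ []
D-paw      = 0 ∷ 1 ∷ 5 ∷ 4 ∷ 1 ∷ []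
D-delete   = 0 ∷ 0 ∷ 4 ∷ 4 ∷ 1 ∷ []
D-contract = 0 ∷ 1 ∷ 3 ∷ 1 ∷ 0 ∷ []
D-extract  = 0 ∷ 0 ∷ 1 ∷ 0 ∷ 0 ∷ []

module _ {c ℓ} (K : CommutativeRing c ℓ) where
  open CommutativeRing K hiding (zero)
  open Poly K
  open PolynomialAlgebra K

  -- The recurrence at the edge {0,1} of the path and of the paw; the
  -- domination polynomials above are obtained by evaluation.
  path-instance : ∀ a b f → RecurrenceHolds K a b f →
    LinComb3 (embed D-path) a (embed D-delete) b (embed D-contract) f (embed D-extract)
  path-instance a b f R = R 4 path v₀ v₁ ≡.refl

  paw-instance : ∀ a b f → RecurrenceHolds K a b f →
    LinComb3 (embed D-paw) a (embed D-delete) b (embed D-contract) f (embed D-extract)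
  paw-instance a b f R = R 4 paw v₀ v₁ ≡.refl

  -- D(paw) - D(P₄) has linear coefficient 1, so it is non-zero unless 1 ≈ 0.
  paw-path-differ : ¬ (1# ≈ 0#) → ¬ ((embed D-paw -P embed D-path) ≈P [])
  paw-path-differ 1≉0 difference≈0 = 1≉0 (begin
    1#                   ≈⟨ +-identityʳ 1# ⟨
    1# + 0#              ≈⟨ +-identityʳ _ ⟨
    (1# + 0#) + 0#       ≈⟨ +-congˡ -0#≈0# ⟨
    (1# + 0#) - 0#       ≈⟨ coeff--P (embed D-paw) (embed D-path) 1 ⟨
    coeff (embed D-paw -P embed D-path) 1 ≈⟨ difference≈0 1 ⟩
    0#                   ∎)
    where
    open import Algebra.Properties.Ring ring using (-0#≈0#)
    open import Relation.Binary.Reasoning.Setoid setoid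

mainTheorem4 : ∀ {c ℓ} (K : CommutativeRing c ℓ) → IsCharZeroField K →
    ¬ (Σ (Poly.RatFun K) λ a → Σ (Poly.RatFun K) λ b → Σ (Poly.RatFun K) λ f →
    RecurrenceHolds K a b f)
mainTheorem4 K F (a , b , f , R) =
  *P-nonzero noZeroDivisors (embed D-paw -P embed D-path) (denSum3 a b f)
    (paw-path-differ K nontrivial)
    (denSum3-nonzero noZeroDivisors a b f)
    (linComb3-difference (embed D-paw) (embed D-path) a b f
      (paw-instance K a b f R) (path-instance K a b f R))
  where
  open Poly K using (embed; denSum3)
  open PolynomialAlgebra K
  open IsCharZeroField F using (nontrivial)
  noZeroDivisors : NoZeroDivisors
  noZeroDivisors = field-noZeroDivisors F
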